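{- For every prime $p$, every positive integer $x$ and every positive integer $n$, \[ \nu_p\bigl(sf^{(n)}(x)\bigr)=\frac{1}{p-1}\left[P_{n+1}(x)-\sum_{a_n=1}^{x}\sum_{a_{n-1}=1}^{a_n}\cdots\sum_{a_1=1}^{a_2}s_p(a_1)\right], \] where there are exactly $n$ nested sums.
   Context: $\nu_p(m)$ denotes the $p$-adic valuation of a positive integer $m$. $s_p(a)$ denotes the sum of the digits of the base-$p$ expansion of the positive integer $a$. For integers $r\ge 0$ and $m\ge 1$, $P_r(m)=\binom{m+r-1}{r}$ is the $r$-simplex (figurate) number. The generalized superfactorial is defined for positive integers $x$ by $sf^{(0)}(x)=x!$ and $sf^{(n)}(x)=\prod_{k=1}^{x}sf^{(n-1)}(k)$ for $n\ge 1$. -}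

module Defs where

open import Data.Nat using (ℕ; zero; suc; _+_; _*_; _∸_; _^_; _≤_; NonZero; _<_; _!)
open import Data.Nat.DivMod using (_/_; _%_)
open import Data.Nat.Divisibility using (_∣_; _∣?_)
open import Data.Nat.Combinatorics using (_C_)
open import Relation.Nullary using (yes; no)

-- Iterated division with fuel: number of times p divides m, while m stays
-- positive (fuel m is always enough when p ≥ 2 and m ≥ 1).
νfuel : ℕ → (p m : ℕ) → .{{NonZero p}} → ℕ
νfuel zero    p m = 0
νfuel (suc f) p zero = 0
νfuel (suc f) p m@(suc _) with p ∣? m
... | yes _ = suc (νfuel f p (m / p))
... | no  _ = 0

-- p-adic valuation ν_p(m) (meaningful for p ≥ 2, m ≥ 1; ν_p(0) = 0 by convention)
ν : (p m : ℕ) → .{{NonZero p}} → ℕ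
ν p m = νfuel m p m

sfuel : ℕ → (p a : ℕ) → .{{NonZero p}} → ℕ
sfuel zero    p a = 0
sfuel (suc f) p a = a % p + sfuel f p (a / p)

-- s_p(a): sum of base-p digits of a (fuel a suffices for p ≥ 2)
s : (p a : ℕ) → .{{NonZero p}} → ℕ
s p a = sfuel a p a

Σ₁ : ℕ → (ℕ → ℕ) → ℕ
Σ₁ zero    f = 0
Σ₁ (suc x) f = Σ₁ x f + f (suc x)

-- nested n-fold sum: N f 0 x = f x ;
-- N f (suc n) x = Σ_{a=1}^{x} N f n a
-- so N f n x = Σ_{a_n=1}^{x} Σ_{a_{n-1}=1}^{a_n} ⋯ Σ_{a_1=1}^{a_2} f a_1
nested : (ℕ → ℕ) → ℕ → ℕ → ℕ
nested f zero    x = f x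
nested f (suc n) x = Σ₁ x (nested f n)

P : ℕ → ℕ → ℕ
P r m = (m + r ∸ 1) C r

Π₁ : ℕ → (ℕ → ℕ) → ℕ
Π₁ zero    f = 1
Π₁ (suc x) f = Π₁ x f * f (suc x)

sf : ℕ → ℕ → ℕ
sf zero    x = x !
sf (suc n) x = Π₁ x (sf n)

{-# OPTIONS --safe #-}
-- Legendre's formula in digit form, (p − 1) ν_p(x!) = x − s_p(x), comes from the
-- one-step identity (p − 1) ν_p(x + 1) + s_p(x + 1) = s_p(x) + 1: adding one to x
-- turns ν_p(x + 1) trailing digits p − 1 into 0 and raises the next digit by one.
-- Since ν_p is additive on products, ν_p(sf⁽ⁿ⁺¹⁾(x)) = Σ_{a ≤ x} ν_p(sf⁽ⁿ⁾(a)), so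
-- the quantity (p − 1) ν_p(sf⁽ⁿ⁾(x)) + (n-fold nested sum of s_p)(x) is obtained from
-- its value for n − 1 by summation; starting from P₁(x) = x, the hockey-stick identity
-- Σ_{a ≤ x} P_{n+1}(a) = P_{n+2}(x) shows that it equals P_{n+1}(x).
module Submission where

open import Defs

-- ℕ arithmetic is confined to this module: the statement below uses the ℤ operators of the same names.
module Legendre where
  open import Data.Nat using (ℕ; zero; suc; _+_; _*_; _∸_; _^_; _≤_; _<_; NonZero; >-nonZero; z<s; s≤s; _!)
  open import Data.Nat.Properties
  open import Data.Nat.DivMod
  open import Data.Nat.Divisibility using (_∣_; _∣?_; divides; ∣⇒≤; ∣m+n∣m⇒∣n; n∣m*n; _∣0)
  open import Data.Nat.Combinatorics using (_C_; nC1≡n; nCk+nC[k+1]≡[n+1]C[k+1]; k>n⇒nCk≡0)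
  open import Data.Nat.Primality using (Prime; euclidsLemma)
  open import Data.Nat.Induction using (<-wellFounded; Acc; acc)
  open import Data.Nat.Tactic.RingSolver using (solve-∀)
  open import Algebra.Properties.CommutativeSemigroup *-commutativeSemigroup using (interchange)
  open import Data.Product using (∃-syntax; _×_; _,_)
  open import Data.Sum using (inj₁; inj₂; [_,_]′)
  open import Relation.Nullary using (¬_; yes; no; contradiction)
  open import Relation.Binary.PropositionalEquality using (_≡_; refl; sym; trans; cong; cong₂; subst; module ≡-Reasoning)

  m^[1+e]*n≡m^e*n*m : ∀ m e n → m ^ suc e * n ≡ m ^ e * n * m
  m^[1+e]*n≡m^e*n*m m e n = trans (*-assoc m (m ^ e) n) (*-comm m (m ^ e * n))

  Σ₁-cong : ∀ x {f g} → (∀ a → f a ≡ g a) → Σ₁ x f ≡ Σ₁ x g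
  Σ₁-cong zero    f≡g = refl
  Σ₁-cong (suc x) f≡g = cong₂ _+_ (Σ₁-cong x f≡g) (f≡g (suc x))

  Σ₁-linear : ∀ c x f g → c * Σ₁ x f + Σ₁ x g ≡ Σ₁ x (λ a → c * f a + g a)
  Σ₁-linear c zero    f g = cong (_+ 0) (*-zeroʳ c)
  Σ₁-linear c (suc x) f g = begin
    c * (Σ₁ x f + f (suc x)) + (Σ₁ x g + g (suc x))
      ≡⟨ regroup c (Σ₁ x f) (f (suc x)) (Σ₁ x g) (g (suc x)) ⟩
    (c * Σ₁ x f + Σ₁ x g) + (c * f (suc x) + g (suc x))
      ≡⟨ cong (_+ (c * f (suc x) + g (suc x))) (Σ₁-linear c x f g) ⟩
    Σ₁ x (λ a → c * f a + g a) + (c * f (suc x) + g (suc x)) ∎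
    where
    open ≡-Reasoning
    regroup : ∀ c F f G g → c * (F + f) + (G + g) ≡ (c * F + G) + (c * f + g)
    regroup = solve-∀

  Π₁-pos : ∀ x {f} → (∀ a → 0 < f a) → 0 < Π₁ x f
  Π₁-pos zero    f>0 = z<s
  Π₁-pos (suc x) f>0 = m*n>0 (Π₁-pos x f>0) (f>0 (suc x))
    where
    m*n>0 : ∀ {m n} → 0 < m → 0 < n → 0 < m * n
    m*n>0 {suc m} {suc n} _ _ = z<s

  sf-pos : ∀ n x → 0 < sf n x
  sf-pos zero    x = 1≤n! x
  sf-pos (suc n) x = Π₁-pos x (sf-pos n)

  P-one : ∀ x → P 1 x ≡ x
  P-one x = trans (cong (_C 1) (m+n∸n≡m x 1)) (nC1≡n x)

  P-suc : ∀ r m → P (suc r) m ≡ (m + r) C suc r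
  P-suc r m = cong (λ t → (t ∸ 1) C suc r) (+-suc m r)

  Σ₁-P≡P : ∀ r x → Σ₁ x (P (suc r)) ≡ P (suc (suc r)) x
  Σ₁-P≡P r zero    = sym (k>n⇒nCk≡0 (n<1+n (suc r)))
  Σ₁-P≡P r (suc x) = begin
    Σ₁ x (P (suc r)) + P (suc r) (suc x)
      ≡⟨ cong₂ _+_ (Σ₁-P≡P r x) (P-suc r (suc x)) ⟩
    P (suc (suc r)) x + (suc x + r) C suc r
      ≡⟨ cong₂ _+_ (P-suc (suc r) x) (cong (_C suc r) (sym (+-suc x r))) ⟩
    (x + suc r) C suc (suc r) + (x + suc r) C suc r
      ≡⟨ +-comm ((x + suc r) C suc (suc r)) _ ⟩
    (x + suc r) C suc r + (x + suc r) C suc (suc r)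
      ≡⟨ nCk+nC[k+1]≡[n+1]C[k+1] (x + suc r) (suc r) ⟩
    suc (x + suc r) C suc (suc r)
      ≡⟨ sym (P-suc (suc r) (suc x)) ⟩
    P (suc (suc r)) (suc x) ∎
    where open ≡-Reasoning

  module _ {p : ℕ} (1<p : 1 < p) where

    private instance
      p-nonZero : NonZero p
      p-nonZero = >-nonZero (<-trans z<s 1<p)

    [1+m]/p≤m : ∀ m → suc m / p ≤ m
    [1+m]/p≤m m = ≤-pred (m/n<m (suc m) p 1<p)

    p∤1 : ¬ p ∣ 1
    p∤1 p∣1 = <⇒≱ 1<p (∣⇒≤ p∣1)

    νfuel-factor : ∀ {f m} → 0 < m → m ≤ f → ∃[ u ] ¬ p ∣ u × m ≡ p ^ νfuel f p m * u
    νfuel-factor {suc f} {suc m} _ (s≤s m≤f) with p ∣? suc m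
    ... | no p∤m = suc m , p∤m , sym (*-identityˡ (suc m))
    ... | yes p∣m with νfuel-factor (m≥n⇒m/n>0 (∣⇒≤ p∣m)) (≤-trans ([1+m]/p≤m m) m≤f)
    ...   | u , p∤u , m/p≡ = u , p∤u , (begin
            suc m                          ≡⟨ m/n*n≡m p∣m ⟨
            suc m / p * p                  ≡⟨ cong (_* p) m/p≡ ⟩
            p ^ νfuel f p (suc m / p) * u * p ≡⟨ m^[1+e]*n≡m^e*n*m p (νfuel f p (suc m / p)) u ⟨
            p ^ suc (νfuel f p (suc m / p)) * u ∎)
      where open ≡-Reasoning

    νfuel-unique : ∀ {f m} e {u} → ¬ p ∣ u → m ≡ p ^ e * u → m ≤ f → νfuel f p m ≡ e
    νfuel-unique {f} {zero} e {u} p∤u 0≡ _ = contradiction (subst (p ∣_) (sym u≡0) (p ∣0)) p∤u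
      where
      u≡0 : u ≡ 0
      u≡0 = m*n≡0⇒m≡0 u (p ^ e) {{m^n≢0 p e}} (trans (*-comm u (p ^ e)) (sym 0≡))
    νfuel-unique {suc f} {suc m} e {u} p∤u m≡ (s≤s m≤f) with p ∣? suc m | e
    ... | yes p∣m | zero   = contradiction (subst (p ∣_) (trans m≡ (*-identityˡ u)) p∣m) p∤u
    ... | yes p∣m | suc e′ = cong suc (νfuel-unique e′ p∤u m/p≡ (≤-trans ([1+m]/p≤m m) m≤f))
      where
      m/p≡ : suc m / p ≡ p ^ e′ * u
      m/p≡ = trans (cong (_/ p) (trans m≡ (m^[1+e]*n≡m^e*n*m p e′ u))) (m*n/n≡m (p ^ e′ * u) p)
    ... | no p∤m  | zero   = refl
    ... | no p∤m  | suc e′ = contradiction (divides (p ^ e′ * u) (trans m≡ (m^[1+e]*n≡m^e*n*m p e′ u))) p∤m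

    ν-factor : ∀ {m} → 0 < m → ∃[ u ] ¬ p ∣ u × m ≡ p ^ ν p m * u
    ν-factor m>0 = νfuel-factor m>0 ≤-refl

    ν-unique : ∀ e {u} → ¬ p ∣ u → ν p (p ^ e * u) ≡ e
    ν-unique e p∤u = νfuel-unique e p∤u refl ≤-refl

    ν-indivisible : ∀ {m} → ¬ p ∣ m → ν p m ≡ 0
    ν-indivisible {m} p∤m = subst (λ t → ν p t ≡ 0) (*-identityˡ m) (ν-unique 0 p∤m)

    ν-*-p : ∀ {m} → 0 < m → ν p (m * p) ≡ suc (ν p m)
    ν-*-p {m} m>0 with ν-factor m>0
    ... | u , p∤u , m≡ = begin
      ν p (m * p)                      ≡⟨ cong (λ t → ν p (t * p)) m≡ ⟩
      ν p (p ^ ν p m * u * p)          ≡⟨ cong (λ t → ν p t) (m^[1+e]*n≡m^e*n*m p (ν p m) u) ⟨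
      ν p (p ^ suc (ν p m) * u)        ≡⟨ ν-unique (suc (ν p m)) p∤u ⟩
      suc (ν p m)                      ∎
      where open ≡-Reasoning

    sfuel-zero : ∀ f → sfuel f p 0 ≡ 0
    sfuel-zero zero    = refl
    sfuel-zero (suc f) = cong₂ _+_ (m*n%n≡0 0 p) (trans (cong (λ t → sfuel f p t) (0/n≡0 p)) (sfuel-zero f))

    sfuel-stable : ∀ {f g a} → a ≤ f → a ≤ g → sfuel f p a ≡ sfuel g p a
    sfuel-stable {f} {g} {zero} _ _ = trans (sfuel-zero f) (sym (sfuel-zero g))
    sfuel-stable {suc f} {suc g} {suc a} (s≤s a≤f) (s≤s a≤g) =
      cong (λ t → suc a % p + t) (sfuel-stable (≤-trans ([1+m]/p≤m a) a≤f) (≤-trans ([1+m]/p≤m a) a≤g))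

    s-step : ∀ a → s p a ≡ a % p + s p (a / p)
    s-step zero    = sym (cong₂ _+_ (m*n%n≡0 0 p) (cong (λ t → s p t) (0/n≡0 p)))
    s-step (suc a) = cong (λ t → suc a % p + t) (sfuel-stable ([1+m]/p≤m a) ≤-refl)

    s-digit : ∀ {r} q → r < p → s p (r + q * p) ≡ r + s p q
    s-digit {r} q r<p = trans (s-step (r + q * p)) (cong₂ (λ d t → d + s p t) lastDigit quotient)
      where
      lastDigit : (r + q * p) % p ≡ r
      lastDigit = trans ([m+kn]%n≡m%n r q p) (m<n⇒m%n≡m r<p)
      quotient : (r + q * p) / p ≡ q
      quotient = trans (+-distrib-/-∣ʳ r (n∣m*n q)) (cong₂ _+_ (m<n⇒m/n≡0 r<p) (m*n/n≡m q p))

    legendre-step-no-carry : ∀ {r} q → suc r < p →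
      (p ∸ 1) * ν p (suc r + q * p) + s p (suc r + q * p) ≡ s p (r + q * p) + 1
    legendre-step-no-carry {r} q 1+r<p = begin
      (p ∸ 1) * ν p (suc r + q * p) + s p (suc r + q * p)
        ≡⟨ cong₂ (λ v t → (p ∸ 1) * v + t) (ν-indivisible p∤1+r+qp) (s-digit q 1+r<p) ⟩
      (p ∸ 1) * 0 + (suc r + s p q)
        ≡⟨ shift (p ∸ 1) r (s p q) ⟩
      (r + s p q) + 1
        ≡⟨ cong (_+ 1) (s-digit q (<-trans (n<1+n r) 1+r<p)) ⟨
      s p (r + q * p) + 1 ∎
      where
      open ≡-Reasoning
      shift : ∀ c r t → c * 0 + (suc r + t) ≡ (r + t) + 1
      shift = solve-∀
      p∤1+r+qp : ¬ p ∣ suc r + q * p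
      p∤1+r+qp p∣ = <⇒≱ 1+r<p (∣⇒≤ (∣m+n∣m⇒∣n (subst (p ∣_) (+-comm (suc r) (q * p)) p∣) (n∣m*n q)))

    legendre-step-carry : ∀ {r} q → suc r ≡ p →
      (p ∸ 1) * ν p (suc q) + s p (suc q) ≡ s p q + 1 →
      (p ∸ 1) * ν p (suc r + q * p) + s p (suc r + q * p) ≡ s p (r + q * p) + 1
    legendre-step-carry {r} q 1+r≡p step-q = begin
      (p ∸ 1) * ν p (suc r + q * p) + s p (suc r + q * p)
        ≡⟨ cong (λ t → (p ∸ 1) * ν p t + s p t) (cong (_+ q * p) 1+r≡p) ⟩
      (p ∸ 1) * ν p (suc q * p) + s p (0 + suc q * p)
        ≡⟨ cong₂ (λ v t → (p ∸ 1) * v + t) (ν-*-p z<s) (s-digit (suc q) (<-trans z<s 1<p)) ⟩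
      (p ∸ 1) * suc (ν p (suc q)) + s p (suc q)
        ≡⟨ carry (p ∸ 1) (ν p (suc q)) (s p (suc q)) ⟩
      (p ∸ 1) + ((p ∸ 1) * ν p (suc q) + s p (suc q))
        ≡⟨ cong₂ _+_ (cong (_∸ 1) (sym 1+r≡p)) step-q ⟩
      r + (s p q + 1)
        ≡⟨ +-assoc r (s p q) 1 ⟨
      (r + s p q) + 1
        ≡⟨ cong (_+ 1) (s-digit q (subst (r <_) 1+r≡p (n<1+n r))) ⟨
      s p (r + q * p) + 1 ∎
      where
      open ≡-Reasoning
      carry : ∀ c v t → c * suc v + t ≡ c + (c * v + t)
      carry = solve-∀

    legendre-step : ∀ x → (p ∸ 1) * ν p (suc x) + s p (suc x) ≡ s p x + 1
    legendre-step x = go x (<-wellFounded x)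
      where
      go : ∀ x → Acc _<_ x → (p ∸ 1) * ν p (suc x) + s p (suc x) ≡ s p x + 1
      go x (acc rec) = subst (λ t → (p ∸ 1) * ν p (suc t) + s p (suc t) ≡ s p t + 1)
        (sym (m≡m%n+[m/n]*n x p)) digits
        where
        q = x / p
        digits : (p ∸ 1) * ν p (suc (x % p) + q * p) + s p (suc (x % p) + q * p) ≡ s p (x % p + q * p) + 1
        digits with m≤n⇒m<n∨m≡n (m%n<n x p)
        ... | inj₁ 1+r<p = legendre-step-no-carry q 1+r<p
        ... | inj₂ 1+r≡p = legendre-step-carry q 1+r≡p (go q (rec q<x))
          where
          q<x : q < x
          q<x = m/n<m x p {{>-nonZero (<-≤-trans (≤-pred (subst (1 <_) (sym 1+r≡p) 1<p)) (m%n≤m x p))}} 1<p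

    ν[1]≡0 : ν p 1 ≡ 0
    ν[1]≡0 = ν-indivisible p∤1

    module _ (p-prime : Prime p) where

      ν-* : ∀ {a b} → 0 < a → 0 < b → ν p (a * b) ≡ ν p a + ν p b
      ν-* {a} {b} a>0 b>0 with ν-factor a>0 | ν-factor b>0
      ... | u , p∤u , a≡ | w , p∤w , b≡ = begin
        ν p (a * b)                             ≡⟨ cong (λ t → ν p t) (cong₂ _*_ a≡ b≡) ⟩
        ν p (p ^ ν p a * u * (p ^ ν p b * w))   ≡⟨ cong (λ t → ν p t) (interchange (p ^ ν p a) u (p ^ ν p b) w) ⟩
        ν p (p ^ ν p a * p ^ ν p b * (u * w))   ≡⟨ cong (λ t → ν p (t * (u * w))) (^-distribˡ-+-* p (ν p a) (ν p b)) ⟨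
        ν p (p ^ (ν p a + ν p b) * (u * w))     ≡⟨ ν-unique (ν p a + ν p b) p∤uw ⟩
        ν p a + ν p b                           ∎
        where
        open ≡-Reasoning
        p∤uw : ¬ p ∣ u * w
        p∤uw p∣uw = [ p∤u , p∤w ]′ (euclidsLemma u w p-prime p∣uw)

      ν-Π₁ : ∀ x {f} → (∀ a → 0 < f a) → ν p (Π₁ x f) ≡ Σ₁ x (λ a → ν p (f a))
      ν-Π₁ zero    f>0 = ν[1]≡0
      ν-Π₁ (suc x) {f} f>0 = trans (ν-* (Π₁-pos x f>0) (f>0 (suc x)))
        (cong (_+ ν p (f (suc x))) (ν-Π₁ x f>0))

      legendre : ∀ x → (p ∸ 1) * ν p (x !) + s p x ≡ x
      legendre zero    = trans (cong (λ v → (p ∸ 1) * v + 0) ν[1]≡0) (cong (_+ 0) (*-zeroʳ (p ∸ 1)))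
      legendre (suc x) = begin
        (p ∸ 1) * ν p (suc x * x !) + s p (suc x)
          ≡⟨ cong (λ v → (p ∸ 1) * v + s p (suc x)) (ν-* z<s (1≤n! x)) ⟩
        (p ∸ 1) * (ν p (suc x) + ν p (x !)) + s p (suc x)
          ≡⟨ regroup (p ∸ 1) (ν p (suc x)) (ν p (x !)) (s p (suc x)) ⟩
        ((p ∸ 1) * ν p (suc x) + s p (suc x)) + (p ∸ 1) * ν p (x !)
          ≡⟨ cong (_+ (p ∸ 1) * ν p (x !)) (legendre-step x) ⟩
        (s p x + 1) + (p ∸ 1) * ν p (x !)
          ≡⟨ swap (s p x) ((p ∸ 1) * ν p (x !)) ⟩
        ((p ∸ 1) * ν p (x !) + s p x) + 1
          ≡⟨ cong (_+ 1) (legendre x) ⟩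
        x + 1
          ≡⟨ +-comm x 1 ⟩
        suc x ∎
        where
        open ≡-Reasoning
        regroup : ∀ c v w t → c * (v + w) + t ≡ (c * v + t) + c * w
        regroup = solve-∀
        swap : ∀ t u → (t + 1) + u ≡ (u + t) + 1
        swap = solve-∀

      legendre-sf : ∀ n x → (p ∸ 1) * ν p (sf n x) + nested (λ a → s p a) n x ≡ P (suc n) x
      legendre-sf zero    x = trans (legendre x) (sym (P-one x))
      legendre-sf (suc n) x = begin
        (p ∸ 1) * ν p (Π₁ x (sf n)) + Σ₁ x (nested (λ a → s p a) n)
          ≡⟨ cong (λ v → (p ∸ 1) * v + Σ₁ x (nested (λ a → s p a) n)) (ν-Π₁ x (sf-pos n)) ⟩
        (p ∸ 1) * Σ₁ x (λ a → ν p (sf n a)) + Σ₁ x (nested (λ a → s p a) n)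
          ≡⟨ Σ₁-linear (p ∸ 1) x (λ a → ν p (sf n a)) (nested (λ a → s p a) n) ⟩
        Σ₁ x (λ a → (p ∸ 1) * ν p (sf n a) + nested (λ a → s p a) n a)
          ≡⟨ Σ₁-cong x (legendre-sf n) ⟩
        Σ₁ x (P (suc n))
          ≡⟨ Σ₁-P≡P n x ⟩
        P (suc (suc n)) x ∎
        where open ≡-Reasoning

open import Data.Nat using (ℕ; suc; _+_; _∸_; _<_; NonZero; nonTrivial⇒n>1)
open import Data.Nat.Properties using (m≤n+m; m+n∸n≡m)
open import Data.Nat.Primality using (Prime; prime⇒nonTrivial)
open import Data.Integer using (+_; _-_; _*_; _⊖_)
import Data.Integer.Properties as ℤ
open import Relation.Binary.PropositionalEquality using (_≡_; refl; sym; trans; cong; module ≡-Reasoning)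
open Legendre using (legendre-sf)

m+n≡o⇒+m≡+o-+n : ∀ {m n o} → m + n ≡ o → + m ≡ + o - + n
m+n≡o⇒+m≡+o-+n {m} {n} refl = sym (begin
  + (m + n) - + n ≡⟨ ℤ.[+m]-[+n]≡m⊖n (m + n) n ⟩
  (m + n) ⊖ n     ≡⟨ ℤ.⊖-≥ (m≤n+m n m) ⟩
  + (m + n ∸ n)   ≡⟨ cong +_ (m+n∸n≡m m n) ⟩
  + m             ∎)
  where open ≡-Reasoning

corollary8p3 : (p x n : ℕ) → .{{_ : NonZero p}} → Prime p → 0 < x → 0 < n →
    (+ (p ∸ 1)) * (+ ν p (sf n x)) ≡ + P (suc n) x - + nested (λ a → s p a) n x
corollary8p3 p x n p-prime _ _ = trans (sym (ℤ.pos-* (p ∸ 1) (ν p (sf n x))))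
  (m+n≡o⇒+m≡+o-+n (legendre-sf 1<p p-prime n x))
  where
  1<p : 1 < p
  1<p = nonTrivial⇒n>1 p {{prime⇒nonTrivial p-prime}}
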